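{- There are infinitely many positive integers $k$ with $\gcd(k, 2\cdot 3\cdot 5\cdot 7) = 1$ such that for every base-ten digit $d \in \{0,1,2,\dots,9\}$ and every integer $n \ge 1$, the number $$s_n = k\cdot 10^n + \frac{d\,(10^n-1)}{9}$$ (the number obtained by appending $n$ copies of the digit $d$ to the right of the decimal representation of $k$) is composite.
   Context: Numbers are written in base ten. Appending $n$ copies of the digit $d$ to the right of the decimal representation of a positive integer $k$ produces the integer $k\cdot 10^n + d(10^n-1)/9$. -}

module Defs where

open import Data.Nat using (ℕ; _+_; _*_; _∸_; _^_; _/_)

appendDigits : ℕ → ℕ → ℕ → ℕ
appendDigits k d n = k * 10 ^ n + (d * (10 ^ n ∸ 1)) / 9

{-# OPTIONS --safe #-}
-- Covering congruences. Let M be the product of the nineteen primes p listed below. Modulo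
-- p the number s_n depends only on k mod p, and from n = 1 on it is periodic in n with
-- period 60: the order of 10 modulo p divides 60, except for p = 2, 5, where s_n ≡ d for
-- n ≥ 1. A finite computation shows that for k₀ below, every digit d and every class of n
-- modulo 60 some p ∣ M divides s_n, so the same p divides s_n for every k ≡ k₀ (mod M), and
-- p ≤ M ≤ k < s_n makes s_n composite. As 210 ∣ M and gcd(k₀, 210) = 1, every
-- k = k₀ + t M is coprime to 210.
module Submission where

open import Defs
open import Data.Nat using (ℕ; _<_; _≥_)
open import Data.Nat.Coprimality using (Coprime)
open import Data.Nat.Primality using (Composite)
open import Data.Product using (Σ; _×_)

open import Data.Nat.Base
  using (zero; suc; _+_; _*_; _∸_; _^_; _/_; _%_; _≤_; z≤n; s≤s; NonZero; >-nonZero; n>1⇒nonTrivial)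
open import Data.Nat.Properties
open import Data.Nat.DivMod
open import Data.Nat.Divisibility
open import Data.Nat.Coprimality using (coprime?)
open import Data.Nat.GeneralisedArithmetic using (iterate)
open import Data.Nat.Tactic.RingSolver using (solve-∀)
open import Data.Empty using (⊥)
open import Data.Fin using (Fin; toℕ; fromℕ<)
open import Data.Fin.Properties using (all?; toℕ-fromℕ<)
open import Data.List using (List; _∷_; [])
open import Data.Nat.ListAction using (product)
open import Data.List.Relation.Unary.Any using (Any; any?; satisfied)
open import Data.Product using (_,_)
open import Relation.Nullary using (Dec; no)
open import Relation.Nullary.Decidable using (from-yes; _×-dec_)
open import Relation.Binary.PropositionalEquality

private
  variable
    A : Set

repunit : ℕ → ℕ
repunit zero    = 0
repunit (suc n) = 10 * repunit n + 1

10^n≡1+9*repunit[n] : ∀ n → 10 ^ n ≡ 1 + 9 * repunit n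
10^n≡1+9*repunit[n] zero    = refl
10^n≡1+9*repunit[n] (suc n) = trans (cong (10 *_) (10^n≡1+9*repunit[n] n)) (shift (repunit n))
  where
  shift : ∀ r → 10 * (1 + 9 * r) ≡ 1 + 9 * (10 * r + 1)
  shift = solve-∀

appendDigits-repunit : ∀ k d n → appendDigits k d n ≡ k * 10 ^ n + d * repunit n
appendDigits-repunit k d n = cong (k * 10 ^ n +_) (begin
  (d * (10 ^ n ∸ 1)) / 9        ≡⟨ cong (λ m → (d * (m ∸ 1)) / 9) (10^n≡1+9*repunit[n] n) ⟩
  (d * (9 * repunit n)) / 9     ≡⟨ cong (_/ 9) (reassoc d (repunit n)) ⟩
  (d * repunit n * 9) / 9       ≡⟨ m*n/n≡m (d * repunit n) 9 ⟩
  d * repunit n                 ∎)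
  where
  open ≡-Reasoning
  reassoc : ∀ d r → d * (9 * r) ≡ d * r * 9
  reassoc = solve-∀

appendDigits-zero : ∀ k d → appendDigits k d 0 ≡ k
appendDigits-zero k d = begin
  appendDigits k d 0  ≡⟨ appendDigits-repunit k d 0 ⟩
  k * 1 + d * 0       ≡⟨ cong₂ _+_ (*-identityʳ k) (*-zeroʳ d) ⟩
  k + 0               ≡⟨ +-identityʳ k ⟩
  k                   ∎
  where open ≡-Reasoning

appendDigits-suc : ∀ k d n → appendDigits k d (suc n) ≡ 10 * appendDigits k d n + d
appendDigits-suc k d n = begin
  appendDigits k d (suc n)                      ≡⟨ appendDigits-repunit k d (suc n) ⟩
  k * (10 * 10 ^ n) + d * (10 * repunit n + 1)  ≡⟨ shift k d (10 ^ n) (repunit n) ⟩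
  10 * (k * 10 ^ n + d * repunit n) + d         ≡⟨ cong (λ m → 10 * m + d) (appendDigits-repunit k d n) ⟨
  10 * appendDigits k d n + d                   ∎
  where
  open ≡-Reasoning
  shift : ∀ k d t r → k * (10 * t) + d * (10 * r + 1) ≡ 10 * (k * t + d * r) + d
  shift = solve-∀

k≤appendDigits : ∀ k d n → k ≤ appendDigits k d n
k≤appendDigits k d n = begin
  k                              ≤⟨ m≤m*n k (10 ^ n) ⦃ m^n≢0 10 n ⦄ ⟩
  k * 10 ^ n                     ≤⟨ m≤m+n (k * 10 ^ n) (d * repunit n) ⟩
  k * 10 ^ n + d * repunit n     ≡⟨ appendDigits-repunit k d n ⟨
  appendDigits k d n             ∎
  where open ≤-Reasoning

k<appendDigits[suc] : ∀ k d n .{{_ : NonZero k}} → k < appendDigits k d (suc n)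
k<appendDigits[suc] k d n = begin-strict
  k                            <⟨ m<m*n k 10 (s≤s (s≤s z≤n)) ⟩
  k * 10                       ≡⟨ *-comm k 10 ⟩
  10 * k                       ≤⟨ *-monoʳ-≤ 10 (k≤appendDigits k d n) ⟩
  10 * appendDigits k d n      ≤⟨ m≤m+n (10 * appendDigits k d n) d ⟩
  10 * appendDigits k d n + d  ≡⟨ appendDigits-suc k d n ⟨
  appendDigits k d (suc n)     ∎
  where open ≤-Reasoning

iterate-suc : ∀ (f : A → A) x n → iterate f x (suc n) ≡ f (iterate f x n)
iterate-suc f x zero    = refl
iterate-suc f x (suc n) = iterate-suc f (f x) n

iterate-+ : ∀ (f : A → A) x m n → iterate f x (m + n) ≡ iterate f (iterate f x m) n
iterate-+ f x zero    n = refl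
iterate-+ f x (suc m) n = iterate-+ f (f x) m n

iterate-periodic : ∀ (f : A → A) y t → iterate f y t ≡ y → ∀ q r → iterate f y (q * t + r) ≡ iterate f y r
iterate-periodic f y t returns zero    r = refl
iterate-periodic f y t returns (suc q) r = begin
  iterate f y (t + q * t + r)            ≡⟨ cong (iterate f y) (+-assoc t (q * t) r) ⟩
  iterate f y (t + (q * t + r))          ≡⟨ iterate-+ f y t (q * t + r) ⟩
  iterate f (iterate f y t) (q * t + r)  ≡⟨ cong (λ z → iterate f z (q * t + r)) returns ⟩
  iterate f y (q * t + r)                ≡⟨ iterate-periodic f y t returns q r ⟩
  iterate f y r                          ∎
  where open ≡-Reasoning

iterate-eventuallyPeriodic : ∀ (f : A → A) x s t .{{_ : NonZero t}} →
  iterate f x (s + t) ≡ iterate f x s → ∀ m → iterate f x (s + m) ≡ iterate f x (s + m % t)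
iterate-eventuallyPeriodic f x s t returns m = begin
  iterate f x (s + m)                    ≡⟨ iterate-+ f x s m ⟩
  iterate f y m                          ≡⟨ cong (iterate f y) (m≡m%n+[m/n]*n m t) ⟩
  iterate f y (m % t + m / t * t)        ≡⟨ cong (iterate f y) (+-comm (m % t) (m / t * t)) ⟩
  iterate f y (m / t * t + m % t)        ≡⟨ iterate-periodic f y t y-returns (m / t) (m % t) ⟩
  iterate f y (m % t)                    ≡⟨ iterate-+ f x s (m % t) ⟨
  iterate f x (s + m % t)                ∎
  where
  open ≡-Reasoning
  y = iterate f x s
  y-returns : iterate f y t ≡ y
  y-returns = trans (sym (iterate-+ f x s t)) returns

[a*m+b]%n≡[a*[m%n]+b]%n : ∀ a m b n .{{_ : NonZero n}} → (a * m + b) % n ≡ (a * (m % n) + b) % n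
[a*m+b]%n≡[a*[m%n]+b]%n a m b n = begin
  (a * m + b) % n                              ≡⟨ cong (λ z → (a * z + b) % n) (m≡m%n+[m/n]*n m n) ⟩
  (a * (m % n + m / n * n) + b) % n            ≡⟨ cong (_% n) (regroup a (m % n) (m / n) n b) ⟩
  (a * (m % n) + b + a * (m / n) * n) % n      ≡⟨ [m+kn]%n≡m%n (a * (m % n) + b) (a * (m / n)) n ⟩
  (a * (m % n) + b) % n                        ∎
  where
  open ≡-Reasoning
  regroup : ∀ a r q n b → a * (r + q * n) + b ≡ a * r + b + a * q * n
  regroup = solve-∀

m%n%d≡m%d : ∀ m n d .{{_ : NonZero n}} .{{_ : NonZero d}} → d ∣ n → m % n % d ≡ m % d
m%n%d≡m%d m n d (divides c n≡c*d) = begin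
  m % n % d                          ≡⟨ [m+kn]%n≡m%n (m % n) (m / n * c) d ⟨
  (m % n + m / n * c * d) % d        ≡⟨ cong (λ z → (m % n + z) % d) (*-assoc (m / n) c d) ⟩
  (m % n + m / n * (c * d)) % d      ≡⟨ cong (λ z → (m % n + m / n * z) % d) n≡c*d ⟨
  (m % n + m / n * n) % d            ≡⟨ cong (_% d) (m≡m%n+[m/n]*n m n) ⟨
  m % d                              ∎
  where open ≡-Reasoning

appendDigitMod : (p : ℕ) .{{_ : NonZero p}} → ℕ → ℕ → ℕ
appendDigitMod p d x = (10 * x + d) % p

appendDigits-%≡iterate : ∀ k d n p .{{_ : NonZero p}} →
  appendDigits k d n % p ≡ iterate (appendDigitMod p d) (k % p) n
appendDigits-%≡iterate k d zero    p = cong (_% p) (appendDigits-zero k d)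
appendDigits-%≡iterate k d (suc n) p = begin
  appendDigits k d (suc n) % p                 ≡⟨ cong (_% p) (appendDigits-suc k d n) ⟩
  (10 * appendDigits k d n + d) % p            ≡⟨ [a*m+b]%n≡[a*[m%n]+b]%n 10 (appendDigits k d n) d p ⟩
  appendDigitMod p d (appendDigits k d n % p)  ≡⟨ cong (appendDigitMod p d) (appendDigits-%≡iterate k d n p) ⟩
  appendDigitMod p d (iterate f (k % p) n)     ≡⟨ iterate-suc f (k % p) n ⟨
  iterate f (k % p) (suc n)                    ∎
  where
  open ≡-Reasoning
  f = appendDigitMod p d

appendDigits-%-cong : ∀ k k′ d n p .{{_ : NonZero p}} →
  k % p ≡ k′ % p → appendDigits k d n % p ≡ appendDigits k′ d n % p
appendDigits-%-cong k k′ d n p k≡k′ = begin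
  appendDigits k d n % p                      ≡⟨ appendDigits-%≡iterate k d n p ⟩
  iterate (appendDigitMod p d) (k % p) n      ≡⟨ cong (λ x → iterate (appendDigitMod p d) x n) k≡k′ ⟩
  iterate (appendDigitMod p d) (k′ % p) n     ≡⟨ appendDigits-%≡iterate k′ d n p ⟨
  appendDigits k′ d n % p                     ∎
  where open ≡-Reasoning

appendDigits-%-eventuallyPeriodic : ∀ k d p .{{_ : NonZero p}} s t .{{_ : NonZero t}} →
  appendDigits k d (s + t) % p ≡ appendDigits k d s % p →
  ∀ m → appendDigits k d (s + m) % p ≡ appendDigits k d (s + m % t) % p
appendDigits-%-eventuallyPeriodic k d p s t returns m = begin
  appendDigits k d (s + m) % p      ≡⟨ appendDigits-%≡iterate k d (s + m) p ⟩
  iterate f (k % p) (s + m)         ≡⟨ iterate-eventuallyPeriodic f (k % p) s t orbit-returns m ⟩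
  iterate f (k % p) (s + m % t)     ≡⟨ appendDigits-%≡iterate k d (s + m % t) p ⟨
  appendDigits k d (s + m % t) % p  ∎
  where
  open ≡-Reasoning
  f = appendDigitMod p d
  orbit-returns : iterate f (k % p) (s + t) ≡ iterate f (k % p) s
  orbit-returns = begin
    iterate f (k % p) (s + t)      ≡⟨ appendDigits-%≡iterate k d (s + t) p ⟨
    appendDigits k d (s + t) % p   ≡⟨ returns ⟩
    appendDigits k d s % p         ≡⟨ appendDigits-%≡iterate k d s p ⟩
    iterate f (k % p) s            ∎

coprime-+-multiple : ∀ k {m} M t → Coprime k m → m ∣ M → Coprime (k + t * M) m
coprime-+-multiple k {m} M t k⊥m m∣M {e} (e∣k+tM , e∣m) =
  k⊥m (∣m+n∣m⇒∣n (subst (e ∣_) (+-comm k (t * M)) e∣k+tM) (∣-trans e∣m (∣n⇒∣m*n t m∣M)) , e∣m)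

coveringPrimes : List ℕ
coveringPrimes = 2 ∷ 3 ∷ 5 ∷ 7 ∷ 11 ∷ 13 ∷ 31 ∷ 37 ∷ 41 ∷ 61 ∷ 101 ∷ 211 ∷ 241 ∷ 271 ∷ 2161 ∷ 3541 ∷ 9091 ∷ 9901 ∷ 27961 ∷ []

M : ℕ
M = product coveringPrimes

k₀ : ℕ
k₀ = 125911860488851196020191511932713727431

-- Matching p against suc _ only supplies the NonZero instance that _%_ needs.
Covers : ℕ → ℕ → ℕ → Set
Covers d j zero        = ⊥
Covers d j p@(suc _)   = 1 < p × p ∣ M
                       × appendDigits k₀ d (1 + 60) % p ≡ appendDigits k₀ d 1 % p
                       × appendDigits k₀ d (1 + j) % p ≡ 0

covers? : ∀ d j p → Dec (Covers d j p)
covers? d j zero      = no λ ()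
covers? d j p@(suc _) = 1 <? p ×-dec p ∣? M
                      ×-dec appendDigits k₀ d (1 + 60) % p ≟ appendDigits k₀ d 1 % p
                      ×-dec appendDigits k₀ d (1 + j) % p ≟ 0

coveringTable : ∀ (d : Fin 10) (j : Fin 60) → Any (Covers (toℕ d) (toℕ j)) coveringPrimes
coveringTable = from-yes (all? {n = 10} λ d → all? {n = 60} λ j → any? (covers? (toℕ d) (toℕ j)) coveringPrimes)

covering : ∀ d → d < 10 → ∀ j → j < 60 → Σ ℕ (Covers d j)
covering d d<10 j j<60 =
  subst₂ (λ d j → Σ ℕ (Covers d j)) (toℕ-fromℕ< d<10) (toℕ-fromℕ< j<60)
    (satisfied (coveringTable (fromℕ< d<10) (fromℕ< j<60)))

covers⇒commonDivisor : ∀ k → k % M ≡ k₀ % M → ∀ d m → Σ ℕ (Covers d (m % 60)) →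
  Σ ℕ λ p → 1 < p × p ∣ M × p ∣ appendDigits k d (1 + m)
covers⇒commonDivisor k k%M≡k₀%M d m (p@(suc _) , 1<p , p∣M , returns , kills) = p , 1<p , p∣M , m%n≡0⇒n∣m _ p (begin
  appendDigits k d (1 + m) % p        ≡⟨ appendDigits-%-cong k k₀ d (1 + m) p k%p≡k₀%p ⟩
  appendDigits k₀ d (1 + m) % p       ≡⟨ appendDigits-%-eventuallyPeriodic k₀ d p 1 60 returns m ⟩
  appendDigits k₀ d (1 + m % 60) % p  ≡⟨ kills ⟩
  0                                   ∎)
  where
  open ≡-Reasoning
  k%p≡k₀%p : k % p ≡ k₀ % p
  k%p≡k₀%p = begin
    k % p          ≡⟨ m%n%d≡m%d k M p p∣M ⟨
    k % M % p      ≡⟨ cong (_% p) k%M≡k₀%M ⟩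
    k₀ % M % p     ≡⟨ m%n%d≡m%d k₀ M p p∣M ⟩
    k₀ % p         ∎

commonDivisor⇒composite : ∀ {m n} .{{_ : NonZero m}} → m < n →
  Σ ℕ (λ p → 1 < p × p ∣ m × p ∣ n) → Composite n
commonDivisor⇒composite m<n (p , 1<p , p∣m , p∣n) =
  hasNonTrivialDivisor ⦃ n>1⇒nonTrivial 1<p ⦄ (≤-<-trans (∣⇒≤ p∣m) m<n) p∣n

appendDigits-composite : ∀ k → k % M ≡ k₀ % M → M ≤ k →
  ∀ d → d < 10 → ∀ n → n ≥ 1 → Composite (appendDigits k d n)
appendDigits-composite k k%M≡k₀%M M≤k d d<10 (suc m) _ =
  commonDivisor⇒composite M<s (covers⇒commonDivisor k k%M≡k₀%M d m (covering d d<10 (m % 60) (m%n<n m 60)))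
  where
  M<s : M < appendDigits k d (suc m)
  M<s = ≤-<-trans M≤k (k<appendDigits[suc] k d m ⦃ >-nonZero (≤-trans (m≤n*m 1 M) M≤k) ⦄)

mainTheorem1 : (N : ℕ) → Σ ℕ (λ k → (N < k) × Coprime k 210
                   × ((d : ℕ) → d < 10 → (n : ℕ) → n ≥ 1 → Composite (appendDigits k d n)))
mainTheorem1 N = k₀ + suc N * M , N<k , k⊥210 , appendDigits-composite (k₀ + suc N * M) k≡k₀ M≤k
  where
  -- The witness is spelt out, not let-bound: unfolding a local name for it makes Agda
  -- normalise k₀ + …, which is unary recursion on a 39-digit literal.
  N<k : N < k₀ + suc N * M
  N<k = ≤-trans (m≤m*n (suc N) M) (m≤n+m (suc N * M) k₀)

  M≤k : M ≤ k₀ + suc N * M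
  M≤k = ≤-trans (m≤n*m M (suc N)) (m≤n+m (suc N * M) k₀)

  k≡k₀ : (k₀ + suc N * M) % M ≡ k₀ % M
  k≡k₀ = [m+kn]%n≡m%n k₀ (suc N) M

  k⊥210 : Coprime (k₀ + suc N * M) 210
  k⊥210 = coprime-+-multiple k₀ M (suc N) (from-yes (coprime? k₀ 210)) (from-yes (210 ∣? M))
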